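{- Let $n\geq1$. A vector $\vec{v}\in\mathbb{N}_b^n$ is the name of a planar rooted binary tree in $Y_n$ if and only if $\mathrm{name}(\mathrm{Tree}(\vec{v}))=\vec{v}$.
   Context: $\mathbb{N}_b^n:=\{(v_1,\ldots,v_n)\in\mathbb{N}^n:\ 0<v_i\leq i\}$. $Y_n$ is the set of planar rooted binary trees with $n$ internal vertices ($n+1$ leaves), identified with complete parenthesizations of $x_1\cdots x_{n+1}$ (each product of two factors $A,B$ written $(AB)$, giving $n$ pairs of parentheses). The name of $\tau\in Y_n$ is $\mathrm{name}(\tau)=(v_1,\ldots,v_n)$ where, in the parenthesization of $\tau$: $v_i=i$ if $x_i$ is immediately preceded by at least one left parenthesis; otherwise $x_i$ is immediately followed by a nonempty block of right parentheses and $v_i=j$, where $x_j$ is the first variable occurring after the left parenthesis matched with the last right parenthesis of that block. For $\vec{v}\in\mathbb{N}_b^n$ with $q_i:=\#\{j: v_j=i\}$, $\mathrm{Tree}(\vec{v})\in Y_n$ is the unique tree whose parenthesization has exactly $q_i$ left parentheses immediately before $x_i$ for each $i\le n$ (obtained by completing $(^{q_1}x_1\cdots(^{q_n}x_nx_{n+1}$ with right parentheses). -}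

module Defs where

open import Data.Nat using (ℕ; zero; suc; _+_; _≤_; _<_; _≟_)
open import Data.Fin using (Fin; toℕ)
open import Data.Vec using (Vec; lookup; tabulate; toList)
open import Data.List using (List; []; _∷_; _++_; replicate; foldl)
open import Data.Maybe using (Maybe; just; nothing; fromMaybe)
open import Data.Product using (Σ; _×_; _,_)
open import Relation.Nullary using (yes; no)
open import Relation.Binary.PropositionalEquality using (_≡_)

data BT : Set where
  leaf : BT
  node : BT → BT → BT

size : BT → ℕ
size leaf       = 0
size (node l r) = suc (size l + size r)

Y : ℕ → Set
Y n = Σ BT (λ t → size t ≡ n)

-- N_b^n = { (v_1,…,v_n) : 0 < v_i ≤ i }   (component i is lookup v i, 0-based Fin index)
InNb : (n : ℕ) → Vec ℕ n → Set
InNb n v = (i : Fin n) → (0 < lookup v i) × (lookup v i ≤ suc (toℕ i))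

data Tok : Set where
  lp  : Tok
  rp  : Tok
  var : ℕ → Tok

paren : ℕ → BT → List Tok
paren s leaf       = var s ∷ []
paren s (node l r) = lp ∷ (paren s l ++ (paren (s + suc (size l)) r ++ (rp ∷ [])))

-- split a token list at the (first) occurrence of var i:
-- returns (reversed prefix, suffix after var i)
splitVar : ℕ → List Tok → List Tok → Maybe (List Tok × List Tok)
splitVar i acc []            = nothing
splitVar i acc (lp ∷ ts)     = splitVar i (lp ∷ acc) ts
splitVar i acc (rp ∷ ts)     = splitVar i (rp ∷ acc) ts
splitVar i acc (var j ∷ ts) with j ≟ i
... | yes _ = just (acc , ts)
... | no  _ = splitVar i (var j ∷ acc) ts

leadingRp : List Tok → ℕ
leadingRp (rp ∷ ts) = suc (leadingRp ts)
leadingRp _         = 0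

-- Walk backwards (the list is the REVERSED text preceding a right parenthesis)
-- to its matching left parenthesis; return the first variable occurring after
-- that left parenthesis (= the last variable seen in the backward walk).
matchVar : ℕ → Maybe ℕ → List Tok → ℕ
matchVar d       lastv []            = 0
matchVar d       lastv (var j ∷ ts)  = matchVar d (just j) ts
matchVar d       lastv (rp ∷ ts)     = matchVar (suc d) lastv ts
matchVar zero    lastv (lp ∷ ts)     = fromMaybe 0 lastv
matchVar (suc d) lastv (lp ∷ ts)     = matchVar d lastv ts

-- v_i read off a parenthesization, following the definition of name(τ).
-- (0 is returned only in situations that cannot occur for i ≤ n.)
nameComp : List Tok → ℕ → ℕ
nameComp ts i with splitVar i [] ts
... | nothing = 0
... | just (lp ∷ _ , post) = i
... | just (pre , post) with leadingRp post
...   | zero  = 0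
...   | suc k = matchVar 0 nothing (replicate k rp ++ (var i ∷ pre))

name : (n : ℕ) → BT → Vec ℕ n
name n t = tabulate (λ (i : Fin n) → nameComp (paren 1 t) (suc (toℕ i)))

-- Tree(v): parse (^{q_1} x_1 ⋯ (^{q_n} x_n x_{n+1}, completing with right
-- parentheses (each "(" opens a product which is closed as soon as its
-- two factors are complete; this completion is forced).

data Item : Set where
  open′ : Item          -- "(" whose left factor is not yet complete
  half  : BT → Item     -- "(" whose left factor t is complete
  fin   : BT → Item

shift : BT → List Item → List Item
shift t []             = fin t ∷ []
shift t (open′ ∷ s)    = half t ∷ s
shift t (half l ∷ s)   = shift (node l t) s
shift t (fin u ∷ s)    = fin u ∷ s

result : List Item → BT
result (fin t ∷ []) = t
result _            = leaf

countEq : ℕ → List ℕ → ℕ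
countEq i []       = 0
countEq i (x ∷ xs) with x ≟ i
... | yes _ = suc (countEq i xs)
... | no  _ = countEq i xs

-- process x_1,…,x_n with q_i left parentheses before x_i (stack top first)
pushOpens : ℕ → List Item → List Item
pushOpens zero    s = s
pushOpens (suc k) s = pushOpens k (open′ ∷ s)

step : (n : ℕ) → Vec ℕ n → List Item → ℕ → List Item
step n v s i = shift leaf (pushOpens (countEq i (toList v)) s)

upFrom1 : ℕ → List ℕ
upFrom1 zero    = []
upFrom1 (suc n) = upFrom1 n ++ (suc n ∷ [])

Tree : (n : ℕ) → Vec ℕ n → BT
Tree n v = result (shift leaf (foldl (step n v) [] (upFrom1 n)))

{-# OPTIONS --safe #-}
module Submission where

-- name(node l r), with leaves numbered from s, is name(l) · s · name(r): the
-- last leaf of the left child l is either l itself, preceded by "(", or is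
-- followed by ")"s ending with the one closing l, whose partner "(" comes just
-- before the first leaf s of l.  Hence q_i counts the internal vertices whose
-- leftmost leaf is x_i, i.e. the "(" just before x_i, and Tree(name τ)
-- re-parses τ with its ")" erased, giving back τ.  Conversely, for v ∈ N_b^n
-- the partial sums Q_i = q_1 + ⋯ + q_i satisfy Q_i ≥ i (as v_j ≤ j) and
-- Q_n = n, so each x_i with i ≤ n closes a pending "(" and x_{n+1} completes a
-- single tree with n internal vertices.

open import Defs
open import Data.Empty using (⊥; ⊥-elim)
import Data.Fin as Fin
open import Data.Fin using (toℕ)
open import Data.List using (List; []; _∷_; _++_; _ʳ++_; [_]; replicate; foldl; length)
open import Data.List.Properties using (++-assoc; ++-identityʳ; ++-ʳ++; foldl-++)
open import Data.List.Relation.Unary.All as All using (All; []; _∷_)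
open import Data.List.Relation.Unary.All.Properties using (++⁺)
open import Data.Maybe using (Maybe; just; nothing)
open import Data.Nat using (ℕ; zero; suc; _+_; _≤_; _<_; _≟_; _≤?_; z≤n; s≤s; s≤s⁻¹)
open import Data.Nat.Properties
open import Algebra.Properties.CommutativeSemigroup +-commutativeSemigroup using (interchange)
open import Data.Nat.Tactic.RingSolver using (solve-∀)
open import Data.Product using (Σ-syntax; ∃-syntax; _×_; _,_; proj₁; proj₂)
open import Data.Unit using (⊤; tt)
import Data.Vec as Vec
open import Data.Vec using (Vec; tabulate; toList; lookup)
open import Data.Vec.Properties using (tabulate-cong; length-toList)
open import Function.Bundles using (_⇔_; mk⇔)
open import Relation.Nullary using (yes; no; ¬_)
open import Relation.Binary.PropositionalEquality
  using (_≡_; refl; sym; trans; cong; cong₂; subst; subst₂; module ≡-Reasoning)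

open ≡-Reasoning

replicate-++-∷ : ∀ {A : Set} m (x : A) ys → replicate m x ++ x ∷ ys ≡ x ∷ replicate m x ++ ys
replicate-++-∷ zero    x ys = refl
replicate-++-∷ (suc m) x ys = cong (x ∷_) (replicate-++-∷ m x ys)

mapRange : ∀ {A : Set} → (ℕ → A) → ℕ → ℕ → List A
mapRange f s zero    = []
mapRange f s (suc m) = f s ∷ mapRange f (suc s) m

mapRange-++ : ∀ {A : Set} (f : ℕ → A) s a b → mapRange f s (a + b) ≡ mapRange f s a ++ mapRange f (s + a) b
mapRange-++ f s zero    b = cong (λ k → mapRange f k b) (sym (+-identityʳ s))
mapRange-++ f s (suc a) b =
  cong (f s ∷_) (trans (mapRange-++ f (suc s) a b)
                       (cong (λ k → mapRange f (suc s) a ++ mapRange f k b) (sym (+-suc s a))))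

mapRange-node : ∀ {A : Set} (f : ℕ → A) s a b →
  mapRange f s (suc (a + b)) ≡ mapRange f s a ++ f (s + a) ∷ mapRange f (s + suc a) b
mapRange-node f s a b = begin
    mapRange f s (suc (a + b))
  ≡⟨ cong (mapRange f s) (+-suc a b) ⟨
    mapRange f s (a + suc b)
  ≡⟨ mapRange-++ f s a (suc b) ⟩
    mapRange f s a ++ f (s + a) ∷ mapRange f (suc (s + a)) b
  ≡⟨ cong (λ k → mapRange f s a ++ f (s + a) ∷ mapRange f k b) (+-suc s a) ⟨
    mapRange f s a ++ f (s + a) ∷ mapRange f (s + suc a) b ∎

mapRange-cong : ∀ {A : Set} {f g : ℕ → A} s m → (∀ i → s ≤ i → f i ≡ g i) →
  mapRange f s m ≡ mapRange g s m
mapRange-cong s zero    f≗g = refl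
mapRange-cong s (suc m) f≗g =
  cong₂ _∷_ (f≗g s ≤-refl) (mapRange-cong (suc s) m (λ i s<i → f≗g i (<⇒≤ s<i)))

toList-tabulate : ∀ {A : Set} n (f : ℕ → A) s →
  toList (tabulate {n = n} (λ i → f (s + toℕ i))) ≡ mapRange f s n
toList-tabulate zero    f s = refl
toList-tabulate (suc n) f s =
  cong₂ _∷_ (cong f (+-identityʳ s))
    (trans (cong toList (tabulate-cong (λ i → cong f (+-suc s (toℕ i))))) (toList-tabulate n f (suc s)))

rightOffset-size : ∀ s l r → s + suc (size l) + size r ≡ s + size (node l r)
rightOffset-size s l r = +-assoc s (suc (size l)) (size r)

left-size< : ∀ s l r → s + size l < s + size (node l r)
left-size< s l r = +-monoʳ-< s (s≤s (m≤m+n (size l) (size r)))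

VarsBelow : ℕ → List Tok → Set
VarsBelow b []           = ⊤
VarsBelow b (var k ∷ ts) = k < b × VarsBelow b ts
VarsBelow b (_ ∷ ts)     = VarsBelow b ts

VarsBelow-++ : ∀ {b} xs {ys} → VarsBelow b xs → VarsBelow b ys → VarsBelow b (xs ++ ys)
VarsBelow-++ []           _          q = q
VarsBelow-++ (lp ∷ xs)    p          q = VarsBelow-++ xs p q
VarsBelow-++ (rp ∷ xs)    p          q = VarsBelow-++ xs p q
VarsBelow-++ (var k ∷ xs) (k<b , p)  q = k<b , VarsBelow-++ xs p q

splitVar-skip : ∀ {j} acc xs ys → VarsBelow j xs → splitVar j acc (xs ++ ys) ≡ splitVar j (xs ʳ++ acc) ys
splitVar-skip     acc []           ys _ = refl
splitVar-skip     acc (lp ∷ xs)    ys p = splitVar-skip (lp ∷ acc) xs ys p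
splitVar-skip     acc (rp ∷ xs)    ys p = splitVar-skip (rp ∷ acc) xs ys p
splitVar-skip {j} acc (var k ∷ xs) ys (k<j , p) with k ≟ j
... | yes refl = ⊥-elim (<-irrefl refl k<j)
... | no _     = splitVar-skip (var k ∷ acc) xs ys p

splitVar-hit : ∀ j acc ys → splitVar j acc (var j ∷ ys) ≡ just (acc , ys)
splitVar-hit j acc ys with j ≟ j
... | yes _  = refl
... | no j≢j = ⊥-elim (j≢j refl)

leadingRp-replicate : ∀ m ys → leadingRp (replicate m rp ++ ys) ≡ m + leadingRp ys
leadingRp-replicate zero    ys = refl
leadingRp-replicate (suc m) ys = cong suc (leadingRp-replicate m ys)

NotOpening : List Tok → Set
NotOpening (lp ∷ _) = ⊥
NotOpening _        = ⊤

-- Parenthesizations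

initParen : ℕ → BT → List Tok
initParen s leaf       = []
initParen s (node l r) = lp ∷ paren s l ++ initParen (s + suc (size l)) r

rightDepth : BT → ℕ
rightDepth leaf       = 0
rightDepth (node l r) = suc (rightDepth r)

paren-node-++ : ∀ s l r ys →
  paren s (node l r) ++ ys ≡ lp ∷ paren s l ++ paren (s + suc (size l)) r ++ rp ∷ ys
paren-node-++ s l r ys =
  cong (lp ∷_) (trans (++-assoc (paren s l) _ ys)
                      (cong (paren s l ++_) (++-assoc (paren (s + suc (size l)) r) [ rp ] ys)))

paren-node-ʳ++ : ∀ s l r R →
  paren s (node l r) ʳ++ R ≡ rp ∷ paren (s + suc (size l)) r ʳ++ paren s l ʳ++ lp ∷ R
paren-node-ʳ++ s l r R = trans (++-ʳ++ (paren s l)) (++-ʳ++ (paren (s + suc (size l)) r))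

paren-last : ∀ t s ys →
  paren s t ++ ys ≡ initParen s t ++ var (s + size t) ∷ replicate (rightDepth t) rp ++ ys
paren-last leaf       s ys = cong (λ k → var k ∷ ys) (sym (+-identityʳ s))
paren-last (node l r) s ys = begin
    paren s (node l r) ++ ys
  ≡⟨ paren-node-++ s l r ys ⟩
    lp ∷ paren s l ++ paren s′ r ++ rp ∷ ys
  ≡⟨ cong (λ w → lp ∷ paren s l ++ w) (paren-last r s′ (rp ∷ ys)) ⟩
    lp ∷ paren s l ++ initParen s′ r ++ var (s′ + size r) ∷ replicate d rp ++ rp ∷ ys
  ≡⟨ cong₂ (λ k w → lp ∷ paren s l ++ initParen s′ r ++ var k ∷ w)
           (rightOffset-size s l r) (replicate-++-∷ d rp ys) ⟩
    lp ∷ paren s l ++ initParen s′ r ++ var (s + size (node l r)) ∷ rp ∷ replicate d rp ++ ys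
  ≡⟨ cong (lp ∷_) (++-assoc (paren s l) (initParen s′ r) _) ⟨
    initParen s (node l r) ++ var (s + size (node l r)) ∷ replicate (rightDepth (node l r)) rp ++ ys ∎
  where
  s′ = s + suc (size l)
  d  = rightDepth r

paren-lastʳ : ∀ t s R →
  paren s t ʳ++ R ≡ replicate (rightDepth t) rp ++ var (s + size t) ∷ initParen s t ʳ++ R
paren-lastʳ leaf       s R = cong (λ k → var k ∷ R) (sym (+-identityʳ s))
paren-lastʳ (node l r) s R = begin
    paren s (node l r) ʳ++ R
  ≡⟨ paren-node-ʳ++ s l r R ⟩
    rp ∷ paren s′ r ʳ++ paren s l ʳ++ lp ∷ R
  ≡⟨ cong (rp ∷_) (paren-lastʳ r s′ _) ⟩
    rp ∷ replicate (rightDepth r) rp ++ var (s′ + size r) ∷ initParen s′ r ʳ++ paren s l ʳ++ lp ∷ R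
  ≡⟨ cong₂ (λ k w → rp ∷ replicate (rightDepth r) rp ++ var k ∷ w)
           (rightOffset-size s l r) (sym (++-ʳ++ (paren s l))) ⟩
    replicate (rightDepth (node l r)) rp ++ var (s + size (node l r)) ∷ initParen s (node l r) ʳ++ R ∎
  where
  s′ = s + suc (size l)

-- Reading a complete parenthesization backwards returns to the same depth, and
-- the last variable met is its first one.
matchVar-paren : ∀ t s d lv R → matchVar d lv (paren s t ʳ++ R) ≡ matchVar d (just s) R
matchVar-paren leaf       s d lv R = refl
matchVar-paren (node l r) s d lv R = begin
    matchVar d lv (paren s (node l r) ʳ++ R)
  ≡⟨ cong (matchVar d lv) (paren-node-ʳ++ s l r R) ⟩
    matchVar (suc d) lv (paren s′ r ʳ++ paren s l ʳ++ lp ∷ R)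
  ≡⟨ matchVar-paren r s′ (suc d) lv _ ⟩
    matchVar (suc d) (just s′) (paren s l ʳ++ lp ∷ R)
  ≡⟨ matchVar-paren l s (suc d) (just s′) (lp ∷ R) ⟩
    matchVar d (just s) R ∎
  where
  s′ = s + suc (size l)

leadingRp-paren : ∀ t s ys → leadingRp (paren s t ++ ys) ≡ 0
leadingRp-paren leaf       s ys = refl
leadingRp-paren (node l r) s ys = refl

notOpening-paren : ∀ t s R → NotOpening (paren s t ʳ++ R)
notOpening-paren leaf       s R = tt
notOpening-paren (node l r) s R = subst NotOpening (sym (paren-node-ʳ++ s l r R)) tt

notOpening-initParen : ∀ t s R → NotOpening R → NotOpening (initParen s t ʳ++ R)
notOpening-initParen leaf       s R p = p
notOpening-initParen (node l r) s R p =
  subst NotOpening (sym (++-ʳ++ (paren s l)))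
        (notOpening-initParen r (s + suc (size l)) _ (notOpening-paren l s (lp ∷ R)))

varsBelow-paren : ∀ t s {b} → s + size t < b → VarsBelow b (paren s t)
varsBelow-paren leaf       s h = ≤-<-trans (m≤m+n s 0) h , tt
varsBelow-paren (node l r) s h =
  VarsBelow-++ (paren s l) (varsBelow-paren l s (<-trans (left-size< s l r) h))
    (VarsBelow-++ (paren (s + suc (size l)) r)
       (varsBelow-paren r _ (≤-<-trans (≤-reflexive (rightOffset-size s l r)) h)) tt)

varsBelow-initParen : ∀ t s → VarsBelow (s + size t) (initParen s t)
varsBelow-initParen leaf       s = tt
varsBelow-initParen (node l r) s =
  VarsBelow-++ (paren s l) (varsBelow-paren l s (left-size< s l r))
    (subst (λ b → VarsBelow b (initParen (s + suc (size l)) r))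
           (rightOffset-size s l r) (varsBelow-initParen r _))

-- The name of a tree

-- `nameComp` with its `with`-abstractions unfolded, so that the accumulator
-- of `splitVar` can be generalised.
nameFromBlock : ℕ → List Tok → ℕ → ℕ
nameFromBlock i pre zero    = 0
nameFromBlock i pre (suc k) = matchVar 0 nothing (replicate k rp ++ (var i ∷ pre))

nameFromSplit : ℕ → Maybe (List Tok × List Tok) → ℕ
nameFromSplit i nothing                = 0
nameFromSplit i (just (lp ∷ _ , post)) = i
nameFromSplit i (just (pre , post))    = nameFromBlock i pre (leadingRp post)

nameComp-split : ∀ ts i → nameComp ts i ≡ nameFromSplit i (splitVar i [] ts)
nameComp-split ts i with splitVar i [] ts
... | nothing               = refl
... | just (lp ∷ _ , post)  = refl
... | just ([] , post) with leadingRp post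
...   | zero  = refl
...   | suc _ = refl
nameComp-split ts i | just (rp ∷ _ , post) with leadingRp post
...   | zero  = refl
...   | suc _ = refl
nameComp-split ts i | just (var _ ∷ _ , post) with leadingRp post
...   | zero  = refl
...   | suc _ = refl

nameFromSplit-closing : ∀ {j pre post k} → NotOpening pre → leadingRp post ≡ suc k →
  nameFromSplit j (just (pre , post)) ≡ matchVar 0 nothing (replicate k rp ++ var j ∷ pre)
nameFromSplit-closing {pre = []}        _ eq rewrite eq = refl
nameFromSplit-closing {pre = lp ∷ _}    ()
nameFromSplit-closing {pre = rp ∷ _}    _ eq rewrite eq = refl
nameFromSplit-closing {pre = var _ ∷ _} _ eq rewrite eq = refl

nameFromSplit-leftLast : ∀ l s r acc ys → let j = s + size l in
  nameFromSplit j (splitVar j acc (lp ∷ paren s l ++ paren (s + suc (size l)) r ++ rp ∷ ys)) ≡ s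
nameFromSplit-leftLast leaf s r acc ys rewrite +-identityʳ s =
  cong (nameFromSplit s) (splitVar-hit s (lp ∷ acc) _)
nameFromSplit-leftLast (node l₁ l₂) s r acc ys = begin
    nameFromSplit j (splitVar j (lp ∷ acc) (paren s (node l₁ l₂) ++ W))
  ≡⟨ cong (λ w → nameFromSplit j (splitVar j (lp ∷ acc) w)) (paren-node-++ s l₁ l₂ W) ⟩
    nameFromSplit j (splitVar j (lp ∷ lp ∷ acc) (paren s l₁ ++ paren s₁ l₂ ++ rp ∷ W))
  ≡⟨ cong (nameFromSplit j)
          (splitVar-skip (lp ∷ lp ∷ acc) (paren s l₁) _ (varsBelow-paren l₁ s (left-size< s l₁ l₂))) ⟩
    nameFromSplit j (splitVar j R (paren s₁ l₂ ++ rp ∷ W))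
  ≡⟨ cong (λ w → nameFromSplit j (splitVar j R w)) (paren-last l₂ s₁ (rp ∷ W)) ⟩
    nameFromSplit j (splitVar j R (initParen s₁ l₂ ++ var (s₁ + size l₂) ∷ replicate d rp ++ rp ∷ W))
  ≡⟨ cong (λ k → nameFromSplit j (splitVar j R (initParen s₁ l₂ ++ var k ∷ replicate d rp ++ rp ∷ W)))
          (rightOffset-size s l₁ l₂) ⟩
    nameFromSplit j (splitVar j R (initParen s₁ l₂ ++ var j ∷ replicate d rp ++ rp ∷ W))
  ≡⟨ cong (nameFromSplit j) (splitVar-skip R (initParen s₁ l₂) _ below) ⟩
    nameFromSplit j (splitVar j (initParen s₁ l₂ ʳ++ R) (var j ∷ replicate d rp ++ rp ∷ W))
  ≡⟨ cong (nameFromSplit j) (splitVar-hit j _ _) ⟩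
    nameFromSplit j (just (initParen s₁ l₂ ʳ++ R , replicate d rp ++ rp ∷ W))
  ≡⟨ nameFromSplit-closing (notOpening-initParen l₂ s₁ R (notOpening-paren l₁ s (lp ∷ lp ∷ acc))) closes ⟩
    matchVar 0 nothing (replicate d rp ++ var j ∷ initParen s₁ l₂ ʳ++ R)
  ≡⟨ cong (λ k → matchVar 0 nothing (replicate d rp ++ var k ∷ initParen s₁ l₂ ʳ++ R))
          (rightOffset-size s l₁ l₂) ⟨
    matchVar 0 nothing (replicate d rp ++ var (s₁ + size l₂) ∷ initParen s₁ l₂ ʳ++ R)
  ≡⟨ cong (matchVar 0 nothing) (paren-lastʳ l₂ s₁ R) ⟨
    matchVar 0 nothing (paren s₁ l₂ ʳ++ R)
  ≡⟨ matchVar-paren l₂ s₁ 0 nothing R ⟩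
    matchVar 0 (just s₁) (paren s l₁ ʳ++ lp ∷ lp ∷ acc)
  ≡⟨ matchVar-paren l₁ s 0 (just s₁) (lp ∷ lp ∷ acc) ⟩
    s ∎
  where
  j  = s + size (node l₁ l₂)
  s₁ = s + suc (size l₁)
  d  = rightDepth l₂
  W  = paren (s + suc (size (node l₁ l₂))) r ++ rp ∷ ys
  R  = paren s l₁ ʳ++ lp ∷ lp ∷ acc
  below : VarsBelow j (initParen s₁ l₂)
  below = subst (λ b → VarsBelow b (initParen s₁ l₂)) (rightOffset-size s l₁ l₂) (varsBelow-initParen l₂ s₁)
  closes : leadingRp (replicate d rp ++ rp ∷ W) ≡ suc d
  closes = trans (leadingRp-replicate d (rp ∷ W))
                 (trans (cong (λ k → d + suc k) (leadingRp-paren r _ (rp ∷ ys))) (+-comm d 1))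

treeName : ℕ → BT → List ℕ
treeName s leaf       = []
treeName s (node l r) = treeName s l ++ s ∷ treeName (s + suc (size l)) r

nameComps-paren : ∀ t s acc ys →
  mapRange (λ j → nameFromSplit j (splitVar j acc (paren s t ++ ys))) s (size t) ≡ treeName s t
nameComps-paren leaf       s acc ys = refl
nameComps-paren (node l r) s acc ys = begin
    mapRange f s (suc (size l + size r))
  ≡⟨ mapRange-node f s (size l) (size r) ⟩
    mapRange f s (size l) ++ f (s + size l) ∷ mapRange f s′ (size r)
  ≡⟨ cong₂ _++_ left (cong₂ _∷_ middle right) ⟩
    treeName s l ++ s ∷ treeName s′ r ∎
  where
  s′ = s + suc (size l)
  f : ℕ → ℕ
  f j = nameFromSplit j (splitVar j acc (paren s (node l r) ++ ys))
  unfold : ∀ j → f j ≡ nameFromSplit j (splitVar j (lp ∷ acc) (paren s l ++ paren s′ r ++ rp ∷ ys))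
  unfold j = cong (λ w → nameFromSplit j (splitVar j acc w)) (paren-node-++ s l r ys)
  left : mapRange f s (size l) ≡ treeName s l
  left = trans (mapRange-cong s (size l) (λ j _ → unfold j)) (nameComps-paren l s (lp ∷ acc) _)
  middle : f (s + size l) ≡ s
  middle = trans (unfold (s + size l)) (nameFromSplit-leftLast l s r acc ys)
  skipLeft : ∀ j → s′ ≤ j →
    f j ≡ nameFromSplit j (splitVar j (paren s l ʳ++ lp ∷ acc) (paren s′ r ++ rp ∷ ys))
  skipLeft j s′≤j = trans (unfold j)
    (cong (nameFromSplit j) (splitVar-skip (lp ∷ acc) (paren s l) _
      (varsBelow-paren l s (<-≤-trans (+-monoʳ-< s (n<1+n (size l))) s′≤j))))
  right : mapRange f s′ (size r) ≡ treeName s′ r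
  right = trans (mapRange-cong s′ (size r) skipLeft) (nameComps-paren r s′ _ (rp ∷ ys))

name-treeName : ∀ t → toList (name (size t) t) ≡ treeName 1 t
name-treeName t = begin
    toList (name (size t) t)
  ≡⟨ toList-tabulate (size t) (nameComp (paren 1 t)) 1 ⟩
    mapRange (nameComp (paren 1 t)) 1 (size t)
  ≡⟨ mapRange-cong 1 (size t) (λ j _ →
       trans (nameComp-split (paren 1 t) j)
             (cong (λ w → nameFromSplit j (splitVar j [] w)) (sym (++-identityʳ (paren 1 t))))) ⟩
    mapRange (λ j → nameFromSplit j (splitVar j [] (paren 1 t ++ []))) 1 (size t)
  ≡⟨ nameComps-paren t 1 [] [] ⟩
    treeName 1 t ∎

-- Tree as a parser

occurrences : List ℕ → ℕ → ℕ
occurrences xs i = countEq i xs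

countEq-++ : ∀ i xs ys → countEq i (xs ++ ys) ≡ countEq i xs + countEq i ys
countEq-++ i []       ys = refl
countEq-++ i (x ∷ xs) ys with x ≟ i
... | yes _ = cong suc (countEq-++ i xs ys)
... | no  _ = countEq-++ i xs ys

countEq-here : ∀ i xs → countEq i (i ∷ xs) ≡ suc (countEq i xs)
countEq-here i xs with i ≟ i
... | yes _  = refl
... | no i≢i = ⊥-elim (i≢i refl)

countEq-there : ∀ {i x} xs → ¬ x ≡ i → countEq i (x ∷ xs) ≡ countEq i xs
countEq-there {i} {x} xs x≢i with x ≟ i
... | yes x≡i = ⊥-elim (x≢i x≡i)
... | no  _   = refl

countEq-absent : ∀ i xs → All (λ x → ¬ x ≡ i) xs → countEq i xs ≡ 0
countEq-absent i []       []         = refl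
countEq-absent i (x ∷ xs) (x≢i ∷ ps) = trans (countEq-there xs x≢i) (countEq-absent i xs ps)

treeName-bounds : ∀ t s → All (λ x → s ≤ x × x < s + size t) (treeName s t)
treeName-bounds leaf       s = []
treeName-bounds (node l r) s =
  ++⁺ (All.map (λ (s≤x , x<) → s≤x , <-trans x< (left-size< s l r)) (treeName-bounds l s))
      ((≤-refl , ≤-<-trans (m≤m+n s (size l)) (left-size< s l r))
       ∷ All.map (λ (s′≤x , x<) → ≤-trans (m≤m+n s _) s′≤x ,
                                  <-≤-trans x< (≤-reflexive (rightOffset-size s l r)))
                 (treeName-bounds r (s + suc (size l))))

countEq-treeName-below : ∀ t s {i} → i < s → countEq i (treeName s t) ≡ 0
countEq-treeName-below t s i<s =
  countEq-absent _ (treeName s t)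
    (All.map (λ (s≤x , _) x≡i → <-irrefl (sym x≡i) (<-≤-trans i<s s≤x)) (treeName-bounds t s))

countEq-treeName-above : ∀ t s {i} → s + size t ≤ i → countEq i (treeName s t) ≡ 0
countEq-treeName-above t s end≤i =
  countEq-absent _ (treeName s t)
    (All.map (λ (_ , x<end) x≡i → <-irrefl x≡i (<-≤-trans x<end end≤i)) (treeName-bounds t s))

-- The parser underlying `Tree`; the words it is run on contain no ")".
parse : List Tok → List Item → List Item
parse []          st = st
parse (lp ∷ w)    st = parse w (open′ ∷ st)
parse (rp ∷ w)    st = parse w st
parse (var _ ∷ w) st = parse w (shift leaf st)

-- `paren s t` with its right parentheses erased.
leftParen : ℕ → BT → List Tok
leftParen s leaf       = var s ∷ []
leftParen s (node l r) = lp ∷ leftParen s l ++ leftParen (s + suc (size l)) r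

word : (ℕ → ℕ) → ℕ → ℕ → List Tok
word q s zero    = []
word q s (suc m) = replicate (q s) lp ++ var s ∷ word q (suc s) m

parse-++ : ∀ u w st → parse (u ++ w) st ≡ parse w (parse u st)
parse-++ []          w st = refl
parse-++ (lp ∷ u)    w st = parse-++ u w (open′ ∷ st)
parse-++ (rp ∷ u)    w st = parse-++ u w st
parse-++ (var _ ∷ u) w st = parse-++ u w (shift leaf st)

parse-lps : ∀ k w st → parse (replicate k lp ++ w) st ≡ parse w (pushOpens k st)
parse-lps zero    w st = refl
parse-lps (suc k) w st = parse-lps k w (open′ ∷ st)

parse-leftParen : ∀ t s w st → parse (leftParen s t ++ w) st ≡ parse w (shift t st)
parse-leftParen leaf       s w st = refl
parse-leftParen (node l r) s w st = begin
    parse ((leftParen s l ++ leftParen s′ r) ++ w) (open′ ∷ st)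
  ≡⟨ cong (λ u → parse u (open′ ∷ st)) (++-assoc (leftParen s l) (leftParen s′ r) w) ⟩
    parse (leftParen s l ++ leftParen s′ r ++ w) (open′ ∷ st)
  ≡⟨ parse-leftParen l s _ (open′ ∷ st) ⟩
    parse (leftParen s′ r ++ w) (half l ∷ st)
  ≡⟨ parse-leftParen r s′ w (half l ∷ st) ⟩
    parse w (shift (node l r) st) ∎
  where
  s′ = s + suc (size l)

word-++ : ∀ q s a b → word q s (a + b) ≡ word q s a ++ word q (s + a) b
word-++ q s zero    b = cong (λ k → word q k b) (sym (+-identityʳ s))
word-++ q s (suc a) b = begin
    replicate (q s) lp ++ var s ∷ word q (suc s) (a + b)
  ≡⟨ cong (λ w → replicate (q s) lp ++ var s ∷ w) (word-++ q (suc s) a b) ⟩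
    replicate (q s) lp ++ var s ∷ word q (suc s) a ++ word q (suc s + a) b
  ≡⟨ cong (λ k → replicate (q s) lp ++ var s ∷ word q (suc s) a ++ word q k b) (+-suc s a) ⟨
    replicate (q s) lp ++ var s ∷ word q (suc s) a ++ word q (s + suc a) b
  ≡⟨ ++-assoc (replicate (q s) lp) _ _ ⟨
    word q s (suc a) ++ word q (s + suc a) b ∎

word-snoc : ∀ q s m → word q s (suc m) ≡ word q s m ++ replicate (q (s + m)) lp ++ var (s + m) ∷ []
word-snoc q s m = trans (cong (word q s) (+-comm 1 m)) (word-++ q s m 1)

word-cong : ∀ {q q′} s m → (∀ i → s ≤ i → i < s + m → q i ≡ q′ i) → word q s m ≡ word q′ s m
word-cong s zero    q≗q′ = refl
word-cong s (suc m) q≗q′ =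
  cong₂ (λ k w → replicate k lp ++ var s ∷ w) (q≗q′ s ≤-refl (m<m+n s (s≤s z≤n)))
    (word-cong (suc s) m (λ i s<i i< → q≗q′ i (<⇒≤ s<i) (<-≤-trans i< (≤-reflexive (sym (+-suc s m))))))

leftParen-word : ∀ t s → leftParen s t ≡ word (occurrences (treeName s t)) s (suc (size t))
leftParen-word leaf       s = refl
leftParen-word (node l r) s = begin
    lp ∷ leftParen s l ++ leftParen s′ r
  ≡⟨ cong₂ (λ u w → lp ∷ u ++ w) (leftParen-word l s) (leftParen-word r s′) ⟩
    lp ∷ word qˡ s (suc a) ++ word qʳ s′ (suc b)
  ≡⟨ cong₂ _++_ leftPart rightPart ⟩
    word q s (suc a) ++ word q s′ (suc b)
  ≡⟨ word-++ q s (suc a) (suc b) ⟨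
    word q s (suc a + suc b)
  ≡⟨ cong (λ k → word q s (suc k)) (+-suc a b) ⟩
    word q s (suc (suc (a + b))) ∎
  where
  a  = size l
  b  = size r
  s′ = s + suc a
  q  = occurrences (treeName s (node l r))
  qˡ = occurrences (treeName s l)
  qʳ = occurrences (treeName s′ r)
  s<s′ : s < s′
  s<s′ = m<m+n s (s≤s z≤n)
  q-split : ∀ i → q i ≡ qˡ i + countEq i (s ∷ treeName s′ r)
  q-split i = countEq-++ i (treeName s l) _
  q-root : q s ≡ suc (qˡ s)
  q-root = begin
      q s
    ≡⟨ q-split s ⟩
      qˡ s + countEq s (s ∷ treeName s′ r)
    ≡⟨ cong (qˡ s +_) (trans (countEq-here s _) (cong suc (countEq-treeName-below r s′ s<s′))) ⟩
      qˡ s + 1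
    ≡⟨ +-comm (qˡ s) 1 ⟩
      suc (qˡ s) ∎
  q-left : ∀ i → s < i → i < s′ → q i ≡ qˡ i
  q-left i s<i i<s′ = begin
      q i
    ≡⟨ q-split i ⟩
      qˡ i + countEq i (s ∷ treeName s′ r)
    ≡⟨ cong (qˡ i +_) (trans (countEq-there _ (<⇒≢ s<i)) (countEq-treeName-below r s′ i<s′)) ⟩
      qˡ i + 0
    ≡⟨ +-identityʳ (qˡ i) ⟩
      qˡ i ∎
  q-right : ∀ i → s′ ≤ i → q i ≡ qʳ i
  q-right i s′≤i = begin
      q i
    ≡⟨ q-split i ⟩
      qˡ i + countEq i (s ∷ treeName s′ r)
    ≡⟨ cong₂ _+_ (countEq-treeName-above l s (<⇒≤ (<-≤-trans (+-monoʳ-< s (n<1+n a)) s′≤i)))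
                 (countEq-there _ (<⇒≢ (<-≤-trans s<s′ s′≤i))) ⟩
      qʳ i ∎
  leftPart : lp ∷ word qˡ s (suc a) ≡ word q s (suc a)
  leftPart = cong₂ (λ k w → replicate k lp ++ var s ∷ w) (sym q-root)
    (word-cong (suc s) a (λ i s<i i< → sym (q-left i s<i (<-≤-trans i< (≤-reflexive (sym (+-suc s a)))))))
  rightPart : word qʳ s′ (suc b) ≡ word q s′ (suc b)
  rightPart = word-cong s′ (suc b) (λ i s′≤i _ → sym (q-right i s′≤i))

foldl-step : ∀ n v m st → foldl (step n v) st (upFrom1 m) ≡ parse (word (occurrences (toList v)) 1 m) st
foldl-step n v zero    st = refl
foldl-step n v (suc m) st = begin
    foldl (step n v) st (upFrom1 m ++ suc m ∷ [])
  ≡⟨ foldl-++ (step n v) st (upFrom1 m) (suc m ∷ []) ⟩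
    shift leaf (pushOpens (q (suc m)) (foldl (step n v) st (upFrom1 m)))
  ≡⟨ cong (λ st′ → shift leaf (pushOpens (q (suc m)) st′)) (foldl-step n v m st) ⟩
    shift leaf (pushOpens (q (suc m)) (parse (word q 1 m) st))
  ≡⟨ parse-lps (q (suc m)) (var (suc m) ∷ []) _ ⟨
    parse (replicate (q (suc m)) lp ++ var (suc m) ∷ []) (parse (word q 1 m) st)
  ≡⟨ parse-++ (word q 1 m) _ st ⟨
    parse (word q 1 m ++ replicate (q (suc m)) lp ++ var (suc m) ∷ []) st
  ≡⟨ cong (λ w → parse w st) (word-snoc q 1 m) ⟨
    parse (word q 1 (suc m)) st ∎
  where
  q = occurrences (toList v)

Tree-parse : ∀ n v → Tree n v ≡ result (shift leaf (parse (word (occurrences (toList v)) 1 n) []))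
Tree-parse n v = cong (λ st → result (shift leaf st)) (foldl-step n v n [])

Tree-name : ∀ t → Tree (size t) (name (size t) t) ≡ t
Tree-name t = begin
    Tree n (name n t)
  ≡⟨ Tree-parse n (name n t) ⟩
    result (shift leaf (parse (word (occurrences (toList (name n t))) 1 n) []))
  ≡⟨ cong (λ xs → result (shift leaf (parse (word (occurrences xs) 1 n) []))) (name-treeName t) ⟩
    result (shift leaf (parse (word q 1 n) []))
  ≡⟨ cong result (parse-++ (word q 1 n) (var (suc n) ∷ []) []) ⟨
    result (parse (word q 1 n ++ var (suc n) ∷ []) [])
  ≡⟨ cong (λ k → result (parse (word q 1 n ++ replicate k lp ++ var (suc n) ∷ []) [])) last-unopened ⟨
    result (parse (word q 1 n ++ replicate (q (suc n)) lp ++ var (suc n) ∷ []) [])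
  ≡⟨ cong (λ w → result (parse w [])) (word-snoc q 1 n) ⟨
    result (parse (word q 1 (suc n)) [])
  ≡⟨ cong (λ w → result (parse w [])) (leftParen-word t 1) ⟨
    result (parse (leftParen 1 t) [])
  ≡⟨ cong (λ w → result (parse w [])) (++-identityʳ (leftParen 1 t)) ⟨
    result (parse (leftParen 1 t ++ []) [])
  ≡⟨ cong result (parse-leftParen t 1 [] []) ⟩
    t ∎
  where
  n = size t
  q = occurrences (treeName 1 t)
  last-unopened : q (suc n) ≡ 0
  last-unopened = countEq-treeName-above t 1 ≤-refl

-- The size of Tree v

-- Unfinished st o z: st holds no completed tree, o of its "(" still wait for a
-- left factor, and it accounts for z internal vertices.
data Unfinished : List Item → ℕ → ℕ → Set where
  []    : Unfinished [] 0 0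
  open′ : ∀ {st o z} → Unfinished st o z → Unfinished (open′ ∷ st) (suc o) (suc z)
  half  : ∀ {st o z} l → Unfinished st o z → Unfinished (half l ∷ st) o (suc (size l + z))

node-size-+ : ∀ a b c → suc (a + b) + c ≡ b + suc (a + c)
node-size-+ = solve-∀

shift-Unfinished : ∀ {st o z} t → Unfinished st (suc o) z → Unfinished (shift t st) o (size t + z)
shift-Unfinished t (open′ {z = z} p) = subst (Unfinished _ _) (sym (+-suc (size t) z)) (half t p)
shift-Unfinished t (half {z = z} l p) =
  subst (Unfinished _ _) (node-size-+ (size l) (size t) z) (shift-Unfinished (node l t) p)

shift-completes : ∀ {st z} t → Unfinished st 0 z → ∃[ u ] shift t st ≡ fin u ∷ [] × size u ≡ size t + z
shift-completes t []                 = t , refl , sym (+-identityʳ (size t))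
shift-completes t (half {z = z} l p) with shift-completes (node l t) p
... | u , shift≡ , size≡ = u , shift≡ , trans size≡ (node-size-+ (size l) (size t) z)

pushOpens-Unfinished : ∀ {st o z} k → Unfinished st o z → Unfinished (pushOpens k st) (k + o) (k + z)
pushOpens-Unfinished zero    p = p
pushOpens-Unfinished {o = o} {z} (suc k) p =
  subst₂ (Unfinished _) (+-suc k o) (+-suc k z) (pushOpens-Unfinished k (open′ p))

sumTo : (ℕ → ℕ) → ℕ → ℕ
sumTo q zero    = 0
sumTo q (suc m) = sumTo q m + q (suc m)

readBlock-Unfinished : ∀ {st o z} k m → o + m ≡ z → suc m ≤ z + k → Unfinished st o z →
  ∃[ o′ ] o′ + suc m ≡ z + k × Unfinished (shift leaf (pushOpens k st)) o′ (z + k)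
readBlock-Unfinished {o = o} {z} k m o+m≡z m<z+k p
  with k + o | pushOpens-Unfinished k p | trans (+-assoc k o m) (trans (cong (k +_) o+m≡z) (+-comm k z))
... | zero   | _  | excess = ⊥-elim (1+n≰n (≤-trans m<z+k (≤-reflexive (sym excess))))
... | suc o′ | p′ | excess =
  o′ , trans (+-suc o′ m) excess , subst (Unfinished _ _) (+-comm k z) (shift-Unfinished leaf p′)

parse-word-Unfinished : ∀ q m → (∀ i → i ≤ m → i ≤ sumTo q i) →
  ∃[ o ] o + m ≡ sumTo q m × Unfinished (parse (word q 1 m) []) o (sumTo q m)
parse-word-Unfinished q zero    ballot = 0 , refl , []
parse-word-Unfinished q (suc m) ballot
  with parse-word-Unfinished q m (λ i i≤m → ballot i (m≤n⇒m≤1+n i≤m))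
... | o , o+m≡Q , p =
  subst (λ st → ∃[ o′ ] o′ + suc m ≡ sumTo q (suc m) × Unfinished st o′ (sumTo q (suc m)))
        (sym parse≡) (readBlock-Unfinished k m o+m≡Q (ballot (suc m) ≤-refl) p)
  where
  k = q (suc m)
  st = parse (word q 1 m) []
  parse≡ : parse (word q 1 (suc m)) [] ≡ shift leaf (pushOpens k st)
  parse≡ = begin
      parse (word q 1 (suc m)) []
    ≡⟨ cong (λ w → parse w []) (word-snoc q 1 m) ⟩
      parse (word q 1 m ++ replicate k lp ++ var (suc m) ∷ []) []
    ≡⟨ parse-++ (word q 1 m) _ [] ⟩
      parse (replicate k lp ++ var (suc m) ∷ []) st
    ≡⟨ parse-lps k _ st ⟩
      shift leaf (pushOpens k st) ∎

parse-word-completes : ∀ q n → (∀ i → i ≤ n → i ≤ sumTo q i) → sumTo q n ≡ n →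
  ∃[ u ] shift leaf (parse (word q 1 n) []) ≡ fin u ∷ [] × size u ≡ n
parse-word-completes q n ballot total with parse-word-Unfinished q n ballot
... | o , o+n≡Q , p with +-cancelʳ-≡ n o 0 (trans o+n≡Q total)
...   | refl with shift-completes leaf p
...     | u , completes , size-u = u , completes , trans size-u total

sumTo-cong : ∀ {q q′} m → (∀ i → q i ≡ q′ i) → sumTo q m ≡ sumTo q′ m
sumTo-cong zero    q≗q′ = refl
sumTo-cong (suc m) q≗q′ = cong₂ _+_ (sumTo-cong m q≗q′) (q≗q′ (suc m))

sumTo-+ : ∀ f g m → sumTo (λ i → f i + g i) m ≡ sumTo f m + sumTo g m
sumTo-+ f g zero    = refl
sumTo-+ f g (suc m) =
  trans (cong (_+ (f (suc m) + g (suc m))) (sumTo-+ f g m)) (interchange (sumTo f m) _ _ _)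

sumTo-occurrences-[] : ∀ m → sumTo (occurrences []) m ≡ 0
sumTo-occurrences-[] zero    = refl
sumTo-occurrences-[] (suc m) = cong (_+ 0) (sumTo-occurrences-[] m)

sumTo-occurrences-∷ : ∀ m x xs →
  sumTo (occurrences (x ∷ xs)) m ≡ sumTo (occurrences [ x ]) m + sumTo (occurrences xs) m
sumTo-occurrences-∷ m x xs =
  trans (sumTo-cong m (λ i → countEq-++ i [ x ] xs)) (sumTo-+ (occurrences [ x ]) (occurrences xs) m)

sumTo-occurrences-beyond : ∀ m x → m < x → sumTo (occurrences [ x ]) m ≡ 0
sumTo-occurrences-beyond zero    x m<x = refl
sumTo-occurrences-beyond (suc m) x m<x =
  cong₂ _+_ (sumTo-occurrences-beyond m x (<-trans (n<1+n m) m<x)) (countEq-there [] (>⇒≢ m<x))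

sumTo-occurrences-within : ∀ m x → 1 ≤ x → x ≤ m → sumTo (occurrences [ x ]) m ≡ 1
sumTo-occurrences-within zero    x 1≤x x≤0 = ⊥-elim (<⇒≱ 1≤x x≤0)
sumTo-occurrences-within (suc m) x 1≤x x≤1+m with x ≟ suc m
... | yes refl rewrite sumTo-occurrences-beyond m (suc m) (n<1+n m) = refl
... | no x≢1+m rewrite sumTo-occurrences-within m x 1≤x (s≤s⁻¹ (≤∧≢⇒< x≤1+m x≢1+m)) = refl

sumTo-occurrences-≤1 : ∀ m x → sumTo (occurrences [ x ]) m ≤ 1
sumTo-occurrences-≤1 zero    x = z≤n
sumTo-occurrences-≤1 (suc m) x with x ≟ suc m
... | yes refl rewrite sumTo-occurrences-beyond m (suc m) (n<1+n m) = ≤-refl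
... | no _     = ≤-trans (≤-reflexive (+-identityʳ _)) (sumTo-occurrences-≤1 m x)

sumTo-occurrences-≤length : ∀ m xs → sumTo (occurrences xs) m ≤ length xs
sumTo-occurrences-≤length m []       = ≤-reflexive (sumTo-occurrences-[] m)
sumTo-occurrences-≤length m (x ∷ xs) =
  ≤-trans (≤-reflexive (sumTo-occurrences-∷ m x xs))
          (+-mono-≤ (sumTo-occurrences-≤1 m x) (sumTo-occurrences-≤length m xs))

-- NbFrom k xs: xs = (v_{k+1}, v_{k+2}, …) with 0 < v_i ≤ i.
NbFrom : ℕ → List ℕ → Set
NbFrom k []       = ⊤
NbFrom k (x ∷ xs) = (1 ≤ x × x ≤ suc k) × NbFrom (suc k) xs

InNb⇒NbFrom : ∀ n k (v : Vec ℕ n) → (∀ i → 0 < lookup v i × lookup v i ≤ suc (k + toℕ i)) →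
  NbFrom k (toList v)
InNb⇒NbFrom zero    k Vec.[]       v∈ = tt
InNb⇒NbFrom (suc n) k (x Vec.∷ v) v∈ =
  (proj₁ (v∈ Fin.zero) , ≤-trans (proj₂ (v∈ Fin.zero)) (≤-reflexive (cong suc (+-identityʳ k))))
  , InNb⇒NbFrom n (suc k) v (λ i → proj₁ (v∈ (Fin.suc i)) ,
                                    ≤-trans (proj₂ (v∈ (Fin.suc i))) (≤-reflexive (cong suc (+-suc k (toℕ i)))))

-- Each of v_{k+1}, …, v_m is at most m, so at least m ∸ k entries are counted.
sumTo-occurrences-ballot : ∀ k m xs → NbFrom k xs → m ≤ k + length xs → m ≤ k + sumTo (occurrences xs) m
sumTo-occurrences-ballot k m [] _ m≤k+0 = ≤-trans m≤k+0 (≤-reflexive (cong (k +_) (sym (sumTo-occurrences-[] m))))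
sumTo-occurrences-ballot k m (x ∷ xs) ((1≤x , x≤1+k) , nb) m≤ with m ≤? k
... | yes m≤k = ≤-trans m≤k (m≤m+n k _)
... | no  m≰k =
  ≤-trans (sumTo-occurrences-ballot (suc k) m xs nb (≤-trans m≤ (≤-reflexive (+-suc k (length xs)))))
          (≤-reflexive counted)
  where
  counted : suc k + sumTo (occurrences xs) m ≡ k + sumTo (occurrences (x ∷ xs)) m
  counted = begin
      suc k + sumTo (occurrences xs) m
    ≡⟨ +-suc k _ ⟨
      k + (1 + sumTo (occurrences xs) m)
    ≡⟨ cong (λ c → k + (c + sumTo (occurrences xs) m))
            (sumTo-occurrences-within m x 1≤x (≤-trans x≤1+k (≰⇒> m≰k))) ⟨
      k + (sumTo (occurrences [ x ]) m + sumTo (occurrences xs) m)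
    ≡⟨ cong (k +_) (sumTo-occurrences-∷ m x xs) ⟨
      k + sumTo (occurrences (x ∷ xs)) m ∎

InNb-ballot : ∀ {n} (v : Vec ℕ n) → InNb n v → ∀ i → i ≤ n → i ≤ sumTo (occurrences (toList v)) i
InNb-ballot {n} v v∈Nb i i≤n =
  sumTo-occurrences-ballot 0 i (toList v) (InNb⇒NbFrom n 0 v v∈Nb)
                           (≤-trans i≤n (≤-reflexive (sym (length-toList v))))

InNb-total : ∀ {n} (v : Vec ℕ n) → InNb n v → sumTo (occurrences (toList v)) n ≡ n
InNb-total {n} v v∈Nb =
  ≤-antisym (≤-trans (sumTo-occurrences-≤length n (toList v)) (≤-reflexive (length-toList v)))
            (InNb-ballot v v∈Nb n ≤-refl)

size-Tree : ∀ {n} (v : Vec ℕ n) → InNb n v → size (Tree n v) ≡ n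
size-Tree {n} v v∈Nb with parse-word-completes _ n (InNb-ballot v v∈Nb) (InNb-total v v∈Nb)
... | u , completes , size-u = trans (cong size (trans (Tree-parse n v) (cong result completes))) size-u

named⇒Tree-fixed : ∀ {n} {v : Vec ℕ n} → Σ[ τ ∈ Y n ] name n (proj₁ τ) ≡ v → name n (Tree n v) ≡ v
named⇒Tree-fixed ((t , refl) , refl) = cong (name (size t)) (Tree-name t)

corollary3p1 : (n : ℕ) → 1 ≤ n → (v : Vec ℕ n) → InNb n v →
    (Σ[ τ ∈ Y n ] name n (proj₁ τ) ≡ v) ⇔ (name n (Tree n v) ≡ v)
corollary3p1 n _ v v∈Nb = mk⇔ named⇒Tree-fixed (λ fixed → (Tree n v , size-Tree v v∈Nb) , fixed)
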